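{- Let $\Sigma\in Sat(\mathsf{BQL}_{\mathsf{CD}})$, let $\Gamma$ be a finite set of $\mathcal{L}^+$-sentences, and let $\phi$ and $\forall v\psi$ be $\mathcal{L}^+$-sentences. If $\Sigma\cup\Gamma\vdash_\Sigma\phi\vee\psi(t)$ for every closed $\mathcal{L}^+$-term $t$, then $\Sigma\cup\Gamma\vdash_\Sigma\phi\vee\forall v\psi$.
   Context: Standing assumption: $\mathcal{L}$ is a countable first-order language whose formulas are built from atomic formulas, $\top$ and $\bot$ using exactly $\wedge,\vee,\rightarrow,\forall,\exists$; $\mathcal{L}^+=\mathcal{L}\cup\{a_i\}_{i\in\omega}$ with the $a_i$ fresh constant symbols; $\phi(t)$ denotes substitution of $t$ for the free variable $v$. The natural deduction system $\mathcal{N}\mathsf{BQL}_{\mathsf{CD}}$ consists of trees of (possibly discharged) $\mathcal{L}^+$-sentences built with the following rules, where all displayed formulas are sentences (so e.g. in CD, $v$ is not free in $\phi$) and $t$ ranges over closed $\mathcal{L}^+$-terms: ($\top$-Int) $\top$ may be placed at a leaf as an already-discharged assumption; ($\bot$-Elim) from $\bot$ infer $\phi$; ($\wedge$-Int) from $\phi,\psi$ infer $\phi\wedge\psi$; ($\wedge$-Elim) from $\phi\wedge\psi$ infer $\phi$, or infer $\psi$; ($\vee$-Int) from $\phi$ or from $\psi$ infer $\phi\vee\psi$; ($\vee$-Elim) from $\phi\vee\psi$, a derivation of $\chi$ from assumption $\phi$ and a derivation of $\chi$ from assumption $\psi$, infer $\chi$, discharging those assumptions; ($\rightarrow$-Int)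 from a derivation of $\psi$ from assumption $\phi$ infer $\phi\rightarrow\psi$, discharging $\phi$; (Internal Transitivity) from $\phi\rightarrow\psi$ and $\psi\rightarrow\chi$ infer $\phi\rightarrow\chi$; (Internal $\wedge$-Int) from $\phi\rightarrow\psi$ and $\phi\rightarrow\chi$ infer $\phi\rightarrow\psi\wedge\chi$; (Internal $\vee$-Elim) from $\phi\rightarrow\chi$ and $\psi\rightarrow\chi$ infer $\phi\vee\psi\rightarrow\chi$; (Internal $\forall$-Int) from $\forall v(\phi\rightarrow\psi)$ infer $\phi\rightarrow\forall v\psi$; (Internal $\exists$-Elim) from $\forall v(\phi\rightarrow\psi)$ infer $\exists v\phi\rightarrow\psi$; ($\forall$-Int) from $\phi(a_i)$ infer $\forall v\phi$, provided $a_i$ occurs neither in $\phi$ nor in any open assumption of the derivation of $\phi(a_i)$; ($\forall$-Elim) from $\forall v\phi$ infer $\phi(t)$; (CD) from $\forall v(\phi\vee\psi)$ infer $\phi\vee\forall v\psi$; ($\exists$-Int) from $\phi(t)$ infer $\exists v\phi$; ($\exists$-Elim) from $\exists v\phi$ and a derivation of $\psi$ from assumption $\phi(a_i)$ infer $\psi$, discharging $\phi(a_i)$, provided $a_i$ occurs neither in $\phi$, nor in $\psi$, nor in any open assumption other than $\phi(a_i)$ of that derivation. There is no modus ponens rule. $\Gamma\vdash\phi$ means there is such a tree with root $\phi$ all of whose open assumptions lie in $\Gamma$. For a set $\Sigma$ of $\mathcal{L}^+$-sentences, $\mathcal{N}\mathsf{BQL}_{\mathsf{CD}}(\Sigma)$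 is obtained from $\mathcal{N}\mathsf{BQL}_{\mathsf{CD}}$ by adding the rule: from $\phi$ and $\phi\rightarrow\psi$ infer $\psi$, where the premise $\phi\rightarrow\psi$ must be the conclusion of a derivation in $\mathcal{N}\mathsf{BQL}_{\mathsf{CD}}$ from assumptions in $\Sigma$. An occurrence of an open assumption lying in such a derivation of the premise $\phi\rightarrow\psi$ of an application of this new rule is called unsafe. Restrictions: (i) no unsafe occurrence of an assumption can be discharged; (ii) in $\exists$-Elim, no occurrence of the assumption $\phi(a_i)$ in the derivation of the minor premise may be unsafe. $\Delta\vdash_\Sigma\phi$ means there is a proof of $\phi$ in $\mathcal{N}\mathsf{BQL}_{\mathsf{CD}}(\Sigma)$ all of whose open assumptions lie in $\Delta$. A set $\Theta$ of $\mathcal{L}^+$-sentences is a prime saturated $\mathsf{BQL}_{\mathsf{CD}}$-theory iff: $\bot\notin\Theta$; if $\Theta\vdash\phi$ then $\phi\in\Theta$; if $\phi\vee\psi\in\Theta$ then $\phi\in\Theta$ or $\psi\in\Theta$; if $\exists v\phi\in\Theta$ then $\phi(t)\in\Theta$ for some closed $\mathcal{L}^+$-term $t$; if $\phi(t)\in\Theta$ for every closed $\mathcal{L}^+$-term $t$ then $\forall v\phi\in\Theta$. $Sat(\mathsf{BQL}_{\mathsf{CD}})$ is the set of these. -}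

module Defs where

open import Data.Nat using (ℕ; zero; suc)
open import Data.Fin using (Fin; zero; suc)
open import Data.Vec using (Vec; []; _∷_)
open import Data.List using (List; []; _∷_)
open import Data.List.Membership.Propositional using (_∈_)
open import Data.List.Relation.Binary.Subset.Propositional using (_⊆_)
open import Data.List.Relation.Unary.All using (All)
open import Data.Empty using (⊥)
open import Data.Sum using (_⊎_)
open import Data.Product using (∃; _×_; _,_)
open import Relation.Nullary using (¬_)
open import Relation.Binary.PropositionalEquality using (_≡_)
open import Function.Definitions using (Injective)

-- A first-order signature L (function symbols incl. constants, relation
-- symbols).  No equality symbol is built in.

record Signature : Set₁ where
  field
    Fun      : Set
    funArity : Fun → ℕ
    Rel      : Set
    relArity : Rel → ℕ

record Countable (L : Signature) : Set where
  open Signature L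
  field
    funCode     : Fun → ℕ
    funCode-inj : Injective _≡_ _≡_ funCode
    relCode     : Rel → ℕ
    relCode-inj : Injective _≡_ _≡_ relCode

module Lang (L : Signature) where
  open Signature L

  private variable
    m n k : ℕ

  -- L⁺-terms with de Bruijn variables; 'con i' is the fresh constant a_i.
  data Term (n : ℕ) : Set where
    var : Fin n → Term n
    con : ℕ → Term n
    app : (f : Fun) → Vec (Term n) (funArity f) → Term n

  infixr 6 _∧'_
  infixr 5 _∨'_
  infixr 4 _⇒_
  data Form (n : ℕ) : Set where
    atom : (r : Rel) → Vec (Term n) (relArity r) → Form n
    ⊤' ⊥' : Form n
    _∧'_ _∨'_ _⇒_ : Form n → Form n → Form n
    ∀' ∃' : Form (suc n) → Form n

  Sentence : Set
  Sentence = Form 0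

  ClosedTerm : Set
  ClosedTerm = Term 0

  mutual
    renT : (Fin m → Fin n) → Term m → Term n
    renT ρ (var x) = var (ρ x)
    renT ρ (con i) = con i
    renT ρ (app f ts) = app f (renTs ρ ts)

    renTs : (Fin m → Fin n) → Vec (Term m) k → Vec (Term n) k
    renTs ρ [] = []
    renTs ρ (t ∷ ts) = renT ρ t ∷ renTs ρ ts

  ext : (Fin m → Fin n) → Fin (suc m) → Fin (suc n)
  ext ρ zero = zero
  ext ρ (suc x) = suc (ρ x)

  ren : (Fin m → Fin n) → Form m → Form n
  ren ρ (atom r ts) = atom r (renTs ρ ts)
  ren ρ ⊤' = ⊤'
  ren ρ ⊥' = ⊥'
  ren ρ (φ ∧' ψ) = ren ρ φ ∧' ren ρ ψ
  ren ρ (φ ∨' ψ) = ren ρ φ ∨' ren ρ ψ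
  ren ρ (φ ⇒ ψ) = ren ρ φ ⇒ ren ρ ψ
  ren ρ (∀' φ) = ∀' (ren (ext ρ) φ)
  ren ρ (∃' φ) = ∃' (ren (ext ρ) φ)

  mutual
    subT : (Fin m → Term n) → Term m → Term n
    subT σ (var x) = σ x
    subT σ (con i) = con i
    subT σ (app f ts) = app f (subTs σ ts)

    subTs : (Fin m → Term n) → Vec (Term m) k → Vec (Term n) k
    subTs σ [] = []
    subTs σ (t ∷ ts) = subT σ t ∷ subTs σ ts

  exts : (Fin m → Term n) → Fin (suc m) → Term (suc n)
  exts σ zero = var zero
  exts σ (suc x) = renT suc (σ x)

  sub : (Fin m → Term n) → Form m → Form n
  sub σ (atom r ts) = atom r (subTs σ ts)
  sub σ ⊤' = ⊤'
  sub σ ⊥' = ⊥'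
  sub σ (φ ∧' ψ) = sub σ φ ∧' sub σ ψ
  sub σ (φ ∨' ψ) = sub σ φ ∨' sub σ ψ
  sub σ (φ ⇒ ψ) = sub σ φ ⇒ sub σ ψ
  sub σ (∀' φ) = ∀' (sub (exts σ) φ)
  sub σ (∃' φ) = ∃' (sub (exts σ) φ)

  -- φ(t): substitute the closed term t for the (single) free variable v
  inst : Form 1 → ClosedTerm → Sentence
  inst φ t = sub (λ _ → t) φ

  -- view a sentence as a formula in which v does not occur free
  wk : Sentence → Form 1
  wk = ren (λ ())

  mutual
    occT : ℕ → Term n → Set
    occT i (var x) = ⊥
    occT i (con j) = i ≡ j
    occT i (app f ts) = occTs i ts

    occTs : ℕ → Vec (Term n) k → Set
    occTs i [] = ⊥
    occTs i (t ∷ ts) = occT i t ⊎ occTs i ts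

  occF : ℕ → Form n → Set
  occF i (atom r ts) = occTs i ts
  occF i ⊤' = ⊥
  occF i ⊥' = ⊥
  occF i (φ ∧' ψ) = occF i φ ⊎ occF i ψ
  occF i (φ ∨' ψ) = occF i φ ⊎ occF i ψ
  occF i (φ ⇒ ψ) = occF i φ ⊎ occF i ψ
  occF i (∀' φ) = occF i φ
  occF i (∃' φ) = occF i φ

  Fresh : ℕ → List Sentence → Set
  Fresh i Δ = All (λ χ → ¬ occF i χ) Δ

  -- NBQL_CD.  'Δ ⊢ φ' : a derivation of φ whose open assumptions are
  -- among Δ.  Discharged assumptions are removed from the context;
  -- 'wkn' lets sub-derivations use smaller contexts, so eigenvariable
  -- conditions refer to (a superset of) the actual open assumptions.

  infix 3 _⊢_
  data _⊢_ : List Sentence → Sentence → Set where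
    hyp  : ∀ {Δ φ} → φ ∈ Δ → Δ ⊢ φ
    wkn  : ∀ {Δ Δ' φ} → Δ ⊆ Δ' → Δ ⊢ φ → Δ' ⊢ φ
    ⊤I   : ∀ {Δ} → Δ ⊢ ⊤'
    ⊥E   : ∀ {Δ φ} → Δ ⊢ ⊥' → Δ ⊢ φ
    ∧I   : ∀ {Δ φ ψ} → Δ ⊢ φ → Δ ⊢ ψ → Δ ⊢ φ ∧' ψ
    ∧E₁  : ∀ {Δ φ ψ} → Δ ⊢ φ ∧' ψ → Δ ⊢ φ
    ∧E₂  : ∀ {Δ φ ψ} → Δ ⊢ φ ∧' ψ → Δ ⊢ ψ
    ∨I₁  : ∀ {Δ φ ψ} → Δ ⊢ φ → Δ ⊢ φ ∨' ψ
    ∨I₂  : ∀ {Δ φ ψ} → Δ ⊢ ψ → Δ ⊢ φ ∨' ψ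
    ∨E   : ∀ {Δ φ ψ χ} → Δ ⊢ φ ∨' ψ → (φ ∷ Δ) ⊢ χ → (ψ ∷ Δ) ⊢ χ → Δ ⊢ χ
    ⇒I   : ∀ {Δ φ ψ} → (φ ∷ Δ) ⊢ ψ → Δ ⊢ φ ⇒ ψ
    iTrans : ∀ {Δ φ ψ χ} → Δ ⊢ φ ⇒ ψ → Δ ⊢ ψ ⇒ χ → Δ ⊢ φ ⇒ χ
    i∧I  : ∀ {Δ φ ψ χ} → Δ ⊢ φ ⇒ ψ → Δ ⊢ φ ⇒ χ → Δ ⊢ φ ⇒ ψ ∧' χ
    i∨E  : ∀ {Δ φ ψ χ} → Δ ⊢ φ ⇒ χ → Δ ⊢ ψ ⇒ χ → Δ ⊢ φ ∨' ψ ⇒ χ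
    i∀I  : ∀ {Δ} {φ : Sentence} {ψ : Form 1} →
           Δ ⊢ ∀' (wk φ ⇒ ψ) → Δ ⊢ φ ⇒ ∀' ψ
    i∃E  : ∀ {Δ} {φ : Form 1} {ψ : Sentence} →
           Δ ⊢ ∀' (φ ⇒ wk ψ) → Δ ⊢ ∃' φ ⇒ ψ
    ∀I   : ∀ {Δ} {φ : Form 1} (i : ℕ) → ¬ occF i φ → Fresh i Δ →
           Δ ⊢ inst φ (con i) → Δ ⊢ ∀' φ
    ∀E   : ∀ {Δ} {φ : Form 1} (t : ClosedTerm) → Δ ⊢ ∀' φ → Δ ⊢ inst φ t
    CD   : ∀ {Δ} {φ : Sentence} {ψ : Form 1} →
           Δ ⊢ ∀' (wk φ ∨' ψ) → Δ ⊢ φ ∨' ∀' ψ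
    ∃I   : ∀ {Δ} {φ : Form 1} (t : ClosedTerm) → Δ ⊢ inst φ t → Δ ⊢ ∃' φ
    ∃E   : ∀ {Δ Δ₂} {φ : Form 1} {ψ : Sentence} (i : ℕ) →
           ¬ occF i φ → ¬ occF i ψ → Fresh i Δ₂ → Δ₂ ⊆ Δ →
           Δ ⊢ ∃' φ → (inst φ (con i) ∷ Δ₂) ⊢ ψ → Δ ⊢ ψ

  _⊩_ : (Sentence → Set) → Sentence → Set
  Θ ⊩ φ = ∃ λ Δ → All Θ Δ × (Δ ⊢ φ)

  -- NBQL_CD(S).  'Δs ∣ Δu ⊢[ S ] φ' : derivation with open safe
  -- assumptions among Δs and open unsafe assumptions among Δu.
  -- Only safe assumptions are ever discharged (restrictions (i),(ii)).

  data DerS (S : Sentence → Set) : List Sentence → List Sentence → Sentence → Set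
  syntax DerS S Δ U φ = Δ ∣ U ⊢[ S ] φ
  infix 3 DerS

  data DerS S where
    hyp  : ∀ {Δ U φ} → φ ∈ Δ → Δ ∣ U ⊢[ S ] φ
    wkn  : ∀ {Δ Δ' U U' φ} → Δ ⊆ Δ' → U ⊆ U' → Δ ∣ U ⊢[ S ] φ → Δ' ∣ U' ⊢[ S ] φ
    ⊤I   : ∀ {Δ U} → Δ ∣ U ⊢[ S ] ⊤'
    ⊥E   : ∀ {Δ U φ} → Δ ∣ U ⊢[ S ] ⊥' → Δ ∣ U ⊢[ S ] φ
    ∧I   : ∀ {Δ U φ ψ} → Δ ∣ U ⊢[ S ] φ → Δ ∣ U ⊢[ S ] ψ → Δ ∣ U ⊢[ S ] φ ∧' ψ
    ∧E₁  : ∀ {Δ U φ ψ} → Δ ∣ U ⊢[ S ] φ ∧' ψ → Δ ∣ U ⊢[ S ] φ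
    ∧E₂  : ∀ {Δ U φ ψ} → Δ ∣ U ⊢[ S ] φ ∧' ψ → Δ ∣ U ⊢[ S ] ψ
    ∨I₁  : ∀ {Δ U φ ψ} → Δ ∣ U ⊢[ S ] φ → Δ ∣ U ⊢[ S ] φ ∨' ψ
    ∨I₂  : ∀ {Δ U φ ψ} → Δ ∣ U ⊢[ S ] ψ → Δ ∣ U ⊢[ S ] φ ∨' ψ
    ∨E   : ∀ {Δ U φ ψ χ} → Δ ∣ U ⊢[ S ] φ ∨' ψ →
           (φ ∷ Δ) ∣ U ⊢[ S ] χ → (ψ ∷ Δ) ∣ U ⊢[ S ] χ → Δ ∣ U ⊢[ S ] χ
    ⇒I   : ∀ {Δ U φ ψ} → (φ ∷ Δ) ∣ U ⊢[ S ] ψ → Δ ∣ U ⊢[ S ] φ ⇒ ψ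
    iTrans : ∀ {Δ U φ ψ χ} → Δ ∣ U ⊢[ S ] φ ⇒ ψ → Δ ∣ U ⊢[ S ] ψ ⇒ χ →
             Δ ∣ U ⊢[ S ] φ ⇒ χ
    i∧I  : ∀ {Δ U φ ψ χ} → Δ ∣ U ⊢[ S ] φ ⇒ ψ → Δ ∣ U ⊢[ S ] φ ⇒ χ →
           Δ ∣ U ⊢[ S ] φ ⇒ ψ ∧' χ
    i∨E  : ∀ {Δ U φ ψ χ} → Δ ∣ U ⊢[ S ] φ ⇒ χ → Δ ∣ U ⊢[ S ] ψ ⇒ χ →
           Δ ∣ U ⊢[ S ] φ ∨' ψ ⇒ χ
    i∀I  : ∀ {Δ U} {φ : Sentence} {ψ : Form 1} →
           Δ ∣ U ⊢[ S ] ∀' (wk φ ⇒ ψ) → Δ ∣ U ⊢[ S ] φ ⇒ ∀' ψ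
    i∃E  : ∀ {Δ U} {φ : Form 1} {ψ : Sentence} →
           Δ ∣ U ⊢[ S ] ∀' (φ ⇒ wk ψ) → Δ ∣ U ⊢[ S ] ∃' φ ⇒ ψ
    ∀I   : ∀ {Δ U} {φ : Form 1} (i : ℕ) → ¬ occF i φ → Fresh i Δ → Fresh i U →
           Δ ∣ U ⊢[ S ] inst φ (con i) → Δ ∣ U ⊢[ S ] ∀' φ
    ∀E   : ∀ {Δ U} {φ : Form 1} (t : ClosedTerm) →
           Δ ∣ U ⊢[ S ] ∀' φ → Δ ∣ U ⊢[ S ] inst φ t
    CD   : ∀ {Δ U} {φ : Sentence} {ψ : Form 1} →
           Δ ∣ U ⊢[ S ] ∀' (wk φ ∨' ψ) → Δ ∣ U ⊢[ S ] φ ∨' ∀' ψ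
    ∃I   : ∀ {Δ U} {φ : Form 1} (t : ClosedTerm) →
           Δ ∣ U ⊢[ S ] inst φ t → Δ ∣ U ⊢[ S ] ∃' φ
    ∃E   : ∀ {Δ U Δ₂ U₂} {φ : Form 1} {ψ : Sentence} (i : ℕ) →
           ¬ occF i φ → ¬ occF i ψ → Fresh i Δ₂ → Fresh i U₂ → Δ₂ ⊆ Δ → U₂ ⊆ U →
           Δ ∣ U ⊢[ S ] ∃' φ → (inst φ (con i) ∷ Δ₂) ∣ U₂ ⊢[ S ] ψ → Δ ∣ U ⊢[ S ] ψ
    -- the new rule: from φ and φ → ψ, where φ → ψ is derived in NBQL_CD
    -- from assumptions U₀ in S; these become unsafe open assumptions
    S-MP : ∀ {Δ U φ ψ} (U₀ : List Sentence) → All S U₀ → U₀ ⊆ U →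
           U₀ ⊢ φ ⇒ ψ → Δ ∣ U ⊢[ S ] φ → Δ ∣ U ⊢[ S ] ψ

  _⊩[_]_ : (Sentence → Set) → (Sentence → Set) → Sentence → Set
  Θ ⊩[ S ] φ = ∃ λ Δ → ∃ λ U → All Θ Δ × All Θ U × (Δ ∣ U ⊢[ S ] φ)

  record Sat (Θ : Sentence → Set) : Set where
    field
      consistent : ¬ Θ ⊥'
      closed     : ∀ φ → Θ ⊩ φ → Θ φ
      prime      : ∀ φ ψ → Θ (φ ∨' ψ) → Θ φ ⊎ Θ ψ
      witness    : ∀ (φ : Form 1) → Θ (∃' φ) → ∃ λ (t : ClosedTerm) → Θ (inst φ t)
      omega      : ∀ (φ : Form 1) → (∀ (t : ClosedTerm) → Θ (inst φ t)) → Θ (∀' φ)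

  _∪_ : (Sentence → Set) → List Sentence → Sentence → Set
  (S ∪ Γ) χ = S χ ⊎ χ ∈ Γ

module Submission where

-- Write ⋀Δ for the conjunction of a list Δ.  Every NBQL_CD(S)-consequence
-- χ of S ∪ Γ is internally implied by ⋀Γ inside S, i.e. S ∋ ⋀Γ → χ.  Hence
-- S ∋ ⋀Γ → φ ∨ ψ(t) for all t, so by the ω-property of S, internal ∀-introduction
-- and CD, S ∋ ⋀Γ → φ ∨ ∀vψ; one application of the new rule of NBQL_CD(S) to
-- ⋀Γ (derivable from Γ) then proves φ ∨ ∀vψ.
--
-- The internalisation is by induction on derivations, for all substitutions σ
-- of closed terms for the constants a_i at once, so that the eigenconstant of
-- ∀I/∃E can be instantiated by every closed term and the ω-property / witness
-- property of S closes these cases.  Since BQL has no modus ponens, three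
-- invariants are needed: (I) Δ ⊢ χ gives S ∋ ⋀σΔ → σχ; (II) Δ ⊢ χ and σΔ ⊆ S
-- give σχ ∈ S (its →I case uses (I)); (III) is (I) for NBQL_CD(S), where the
-- premise of the new rule is handled by (II).

open import Defs
open import Data.Nat using (ℕ; suc; _⊔_; _≤_; _≟_)
open import Data.Nat.Properties using (m≤m⊔n; m≤n⊔m; ≤-trans; ≤-reflexive; 1+n≰n)
open import Data.Fin using (Fin; zero; suc)
open import Data.Vec using (Vec; []; _∷_)
open import Data.List using (List; []; _∷_; map)
open import Data.List.Properties using (map-cong; map-cong-local; map-id)
open import Data.List.Membership.Propositional using (_∈_)
open import Data.List.Membership.Propositional.Properties using (∈-map⁺)
open import Data.List.Relation.Binary.Subset.Propositional using (_⊆_)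
open import Data.List.Relation.Binary.Subset.Propositional.Properties using (map⁺)
open import Data.List.Relation.Unary.Any using (here; there)
open import Data.List.Relation.Unary.All using (All; []; _∷_)
import Data.List.Relation.Unary.All as All
open import Data.Empty using (⊥-elim)
open import Data.Sum using (inj₁; inj₂; map₂)
open import Function using (_∘_)
open import Data.Product using (∃; _,_)
open import Relation.Nullary using (¬_; yes; no)
open import Relation.Binary.PropositionalEquality
  using (_≡_; refl; sym; trans; cong; cong₂; subst; subst₂)

-- (1) Substituting closed terms for the constants a_i.
module ConstantSubstitution (L : Signature) where
  open Lang L

  mutual
    close : ∀ {n} → ClosedTerm → Term n
    close (var ())
    close (con i) = con i
    close (app f ts) = app f (closes ts)

    closes : ∀ {n k} → Vec ClosedTerm k → Vec (Term n) k
    closes [] = []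
    closes (t ∷ ts) = close t ∷ closes ts

  mutual
    renT-close : ∀ {m n} (ρ : Fin m → Fin n) (t : ClosedTerm) → renT ρ (close t) ≡ close t
    renT-close ρ (var ())
    renT-close ρ (con i) = refl
    renT-close ρ (app f ts) = cong (app f) (renTs-closes ρ ts)

    renTs-closes : ∀ {m n k} (ρ : Fin m → Fin n) (ts : Vec ClosedTerm k) →
                   renTs ρ (closes ts) ≡ closes ts
    renTs-closes ρ [] = refl
    renTs-closes ρ (t ∷ ts) = cong₂ _∷_ (renT-close ρ t) (renTs-closes ρ ts)

  mutual
    subT-close : ∀ {m n} (τ : Fin m → Term n) (t : ClosedTerm) → subT τ (close t) ≡ close t
    subT-close τ (var ())
    subT-close τ (con i) = refl
    subT-close τ (app f ts) = cong (app f) (subTs-closes τ ts)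

    subTs-closes : ∀ {m n k} (τ : Fin m → Term n) (ts : Vec ClosedTerm k) →
                   subTs τ (closes ts) ≡ closes ts
    subTs-closes τ [] = refl
    subTs-closes τ (t ∷ ts) = cong₂ _∷_ (subT-close τ t) (subTs-closes τ ts)

  mutual
    close-id : (t : ClosedTerm) → close t ≡ t
    close-id (var ())
    close-id (con i) = refl
    close-id (app f ts) = cong (app f) (closes-id ts)

    closes-id : ∀ {k} (ts : Vec ClosedTerm k) → closes ts ≡ ts
    closes-id [] = refl
    closes-id (t ∷ ts) = cong₂ _∷_ (close-id t) (closes-id ts)

  ConstSub : Set
  ConstSub = ℕ → ClosedTerm

  mutual
    csubT : ∀ {n} → ConstSub → Term n → Term n
    csubT σ (var x) = var x
    csubT σ (con i) = close (σ i)
    csubT σ (app f ts) = app f (csubTs σ ts)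

    csubTs : ∀ {n k} → ConstSub → Vec (Term n) k → Vec (Term n) k
    csubTs σ [] = []
    csubTs σ (t ∷ ts) = csubT σ t ∷ csubTs σ ts

  csub : ∀ {n} → ConstSub → Form n → Form n
  csub σ (atom r ts) = atom r (csubTs σ ts)
  csub σ ⊤' = ⊤'
  csub σ ⊥' = ⊥'
  csub σ (φ ∧' ψ) = csub σ φ ∧' csub σ ψ
  csub σ (φ ∨' ψ) = csub σ φ ∨' csub σ ψ
  csub σ (φ ⇒ ψ) = csub σ φ ⇒ csub σ ψ
  csub σ (∀' φ) = ∀' (csub σ φ)
  csub σ (∃' φ) = ∃' (csub σ φ)

  csubs : ConstSub → List Sentence → List Sentence
  csubs σ = map (csub σ)

  mutual
    csubT-ren : ∀ {m n} σ (ρ : Fin m → Fin n) (t : Term m) →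
                csubT σ (renT ρ t) ≡ renT ρ (csubT σ t)
    csubT-ren σ ρ (var x) = refl
    csubT-ren σ ρ (con i) = sym (renT-close ρ (σ i))
    csubT-ren σ ρ (app f ts) = cong (app f) (csubTs-ren σ ρ ts)

    csubTs-ren : ∀ {m n k} σ (ρ : Fin m → Fin n) (ts : Vec (Term m) k) →
                 csubTs σ (renTs ρ ts) ≡ renTs ρ (csubTs σ ts)
    csubTs-ren σ ρ [] = refl
    csubTs-ren σ ρ (t ∷ ts) = cong₂ _∷_ (csubT-ren σ ρ t) (csubTs-ren σ ρ ts)

  csub-ren : ∀ {m n} σ (ρ : Fin m → Fin n) (φ : Form m) → csub σ (ren ρ φ) ≡ ren ρ (csub σ φ)
  csub-ren σ ρ (atom r ts) = cong (atom r) (csubTs-ren σ ρ ts)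
  csub-ren σ ρ ⊤' = refl
  csub-ren σ ρ ⊥' = refl
  csub-ren σ ρ (φ ∧' ψ) = cong₂ _∧'_ (csub-ren σ ρ φ) (csub-ren σ ρ ψ)
  csub-ren σ ρ (φ ∨' ψ) = cong₂ _∨'_ (csub-ren σ ρ φ) (csub-ren σ ρ ψ)
  csub-ren σ ρ (φ ⇒ ψ) = cong₂ _⇒_ (csub-ren σ ρ φ) (csub-ren σ ρ ψ)
  csub-ren σ ρ (∀' φ) = cong ∀' (csub-ren σ (ext ρ) φ)
  csub-ren σ ρ (∃' φ) = cong ∃' (csub-ren σ (ext ρ) φ)

  mutual
    csubT-sub : ∀ {m n} σ (τ τ' : Fin m → Term n) → (∀ x → csubT σ (τ x) ≡ τ' x) →
                (t : Term m) → csubT σ (subT τ t) ≡ subT τ' (csubT σ t)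
    csubT-sub σ τ τ' h (var x) = h x
    csubT-sub σ τ τ' h (con i) = sym (subT-close τ' (σ i))
    csubT-sub σ τ τ' h (app f ts) = cong (app f) (csubTs-sub σ τ τ' h ts)

    csubTs-sub : ∀ {m n k} σ (τ τ' : Fin m → Term n) → (∀ x → csubT σ (τ x) ≡ τ' x) →
                 (ts : Vec (Term m) k) → csubTs σ (subTs τ ts) ≡ subTs τ' (csubTs σ ts)
    csubTs-sub σ τ τ' h [] = refl
    csubTs-sub σ τ τ' h (t ∷ ts) = cong₂ _∷_ (csubT-sub σ τ τ' h t) (csubTs-sub σ τ τ' h ts)

  csub-exts : ∀ {m n} σ (τ τ' : Fin m → Term n) → (∀ x → csubT σ (τ x) ≡ τ' x) →
              ∀ x → csubT σ (exts τ x) ≡ exts τ' x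
  csub-exts σ τ τ' h zero = refl
  csub-exts σ τ τ' h (suc x) = trans (csubT-ren σ suc (τ x)) (cong (renT suc) (h x))

  csub-sub : ∀ {m n} σ (τ τ' : Fin m → Term n) → (∀ x → csubT σ (τ x) ≡ τ' x) →
             (φ : Form m) → csub σ (sub τ φ) ≡ sub τ' (csub σ φ)
  csub-sub σ τ τ' h (atom r ts) = cong (atom r) (csubTs-sub σ τ τ' h ts)
  csub-sub σ τ τ' h ⊤' = refl
  csub-sub σ τ τ' h ⊥' = refl
  csub-sub σ τ τ' h (φ ∧' ψ) = cong₂ _∧'_ (csub-sub σ τ τ' h φ) (csub-sub σ τ τ' h ψ)
  csub-sub σ τ τ' h (φ ∨' ψ) = cong₂ _∨'_ (csub-sub σ τ τ' h φ) (csub-sub σ τ τ' h ψ)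
  csub-sub σ τ τ' h (φ ⇒ ψ) = cong₂ _⇒_ (csub-sub σ τ τ' h φ) (csub-sub σ τ τ' h ψ)
  csub-sub σ τ τ' h (∀' φ) = cong ∀' (csub-sub σ (exts τ) (exts τ') (csub-exts σ τ τ' h) φ)
  csub-sub σ τ τ' h (∃' φ) = cong ∃' (csub-sub σ (exts τ) (exts τ') (csub-exts σ τ τ' h) φ)

  mutual
    subT-renT-inverse : ∀ {m n} (ρ : Fin m → Fin n) (τ : Fin n → Term m) →
                        (∀ x → τ (ρ x) ≡ var x) → (t : Term m) → subT τ (renT ρ t) ≡ t
    subT-renT-inverse ρ τ h (var x) = h x
    subT-renT-inverse ρ τ h (con i) = refl
    subT-renT-inverse ρ τ h (app f ts) = cong (app f) (subTs-renTs-inverse ρ τ h ts)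

    subTs-renTs-inverse : ∀ {m n k} (ρ : Fin m → Fin n) (τ : Fin n → Term m) →
                          (∀ x → τ (ρ x) ≡ var x) → (ts : Vec (Term m) k) →
                          subTs τ (renTs ρ ts) ≡ ts
    subTs-renTs-inverse ρ τ h [] = refl
    subTs-renTs-inverse ρ τ h (t ∷ ts) =
      cong₂ _∷_ (subT-renT-inverse ρ τ h t) (subTs-renTs-inverse ρ τ h ts)

  exts-inverse : ∀ {m n} (ρ : Fin m → Fin n) (τ : Fin n → Term m) →
                 (∀ x → τ (ρ x) ≡ var x) → ∀ x → exts τ (ext ρ x) ≡ var x
  exts-inverse ρ τ h zero = refl
  exts-inverse ρ τ h (suc x) = cong (renT suc) (h x)

  sub-ren-inverse : ∀ {m n} (ρ : Fin m → Fin n) (τ : Fin n → Term m) →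
                    (∀ x → τ (ρ x) ≡ var x) → (φ : Form m) → sub τ (ren ρ φ) ≡ φ
  sub-ren-inverse ρ τ h (atom r ts) = cong (atom r) (subTs-renTs-inverse ρ τ h ts)
  sub-ren-inverse ρ τ h ⊤' = refl
  sub-ren-inverse ρ τ h ⊥' = refl
  sub-ren-inverse ρ τ h (φ ∧' ψ) = cong₂ _∧'_ (sub-ren-inverse ρ τ h φ) (sub-ren-inverse ρ τ h ψ)
  sub-ren-inverse ρ τ h (φ ∨' ψ) = cong₂ _∨'_ (sub-ren-inverse ρ τ h φ) (sub-ren-inverse ρ τ h ψ)
  sub-ren-inverse ρ τ h (φ ⇒ ψ) = cong₂ _⇒_ (sub-ren-inverse ρ τ h φ) (sub-ren-inverse ρ τ h ψ)
  sub-ren-inverse ρ τ h (∀' φ) = cong ∀' (sub-ren-inverse (ext ρ) (exts τ) (exts-inverse ρ τ h) φ)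
  sub-ren-inverse ρ τ h (∃' φ) = cong ∃' (sub-ren-inverse (ext ρ) (exts τ) (exts-inverse ρ τ h) φ)

  inst-wk : (A : Sentence) (t : ClosedTerm) → inst (wk A) t ≡ A
  inst-wk A t = sub-ren-inverse (λ ()) (λ _ → t) (λ ()) A

  csub-inst : ∀ σ (φ : Form 1) (t : ClosedTerm) → csub σ (inst φ t) ≡ inst (csub σ φ) (csubT σ t)
  csub-inst σ φ t = csub-sub σ (λ _ → t) (λ _ → csubT σ t) (λ _ → refl) φ

  csub-wk : ∀ σ (A : Sentence) → csub σ (wk A) ≡ wk (csub σ A)
  csub-wk σ A = csub-ren σ (λ ()) A

  mutual
    csubT-agree : ∀ {n} σ σ' (t : Term n) → (∀ k → occT k t → σ k ≡ σ' k) →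
                  csubT σ t ≡ csubT σ' t
    csubT-agree σ σ' (var x) h = refl
    csubT-agree σ σ' (con i) h = cong close (h i refl)
    csubT-agree σ σ' (app f ts) h = cong (app f) (csubTs-agree σ σ' ts h)

    csubTs-agree : ∀ {n k} σ σ' (ts : Vec (Term n) k) → (∀ k → occTs k ts → σ k ≡ σ' k) →
                   csubTs σ ts ≡ csubTs σ' ts
    csubTs-agree σ σ' [] h = refl
    csubTs-agree σ σ' (t ∷ ts) h =
      cong₂ _∷_ (csubT-agree σ σ' t (λ k o → h k (inj₁ o)))
                (csubTs-agree σ σ' ts (λ k o → h k (inj₂ o)))

  csub-agree : ∀ {n} σ σ' (φ : Form n) → (∀ k → occF k φ → σ k ≡ σ' k) → csub σ φ ≡ csub σ' φ
  csub-agree σ σ' (atom r ts) h = cong (atom r) (csubTs-agree σ σ' ts h)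
  csub-agree σ σ' ⊤' h = refl
  csub-agree σ σ' ⊥' h = refl
  csub-agree σ σ' (φ ∧' ψ) h =
    cong₂ _∧'_ (csub-agree σ σ' φ (λ k o → h k (inj₁ o)))
               (csub-agree σ σ' ψ (λ k o → h k (inj₂ o)))
  csub-agree σ σ' (φ ∨' ψ) h =
    cong₂ _∨'_ (csub-agree σ σ' φ (λ k o → h k (inj₁ o)))
               (csub-agree σ σ' ψ (λ k o → h k (inj₂ o)))
  csub-agree σ σ' (φ ⇒ ψ) h =
    cong₂ _⇒_ (csub-agree σ σ' φ (λ k o → h k (inj₁ o)))
              (csub-agree σ σ' ψ (λ k o → h k (inj₂ o)))
  csub-agree σ σ' (∀' φ) h = cong ∀' (csub-agree σ σ' φ h)
  csub-agree σ σ' (∃' φ) h = cong ∃' (csub-agree σ σ' φ h)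

  mutual
    csubT-con : ∀ {n} (t : Term n) → csubT con t ≡ t
    csubT-con (var x) = refl
    csubT-con (con i) = refl
    csubT-con (app f ts) = cong (app f) (csubTs-con ts)

    csubTs-con : ∀ {n k} (ts : Vec (Term n) k) → csubTs con ts ≡ ts
    csubTs-con [] = refl
    csubTs-con (t ∷ ts) = cong₂ _∷_ (csubT-con t) (csubTs-con ts)

  csub-con : ∀ {n} (φ : Form n) → csub con φ ≡ φ
  csub-con (atom r ts) = cong (atom r) (csubTs-con ts)
  csub-con ⊤' = refl
  csub-con ⊥' = refl
  csub-con (φ ∧' ψ) = cong₂ _∧'_ (csub-con φ) (csub-con ψ)
  csub-con (φ ∨' ψ) = cong₂ _∨'_ (csub-con φ) (csub-con ψ)
  csub-con (φ ⇒ ψ) = cong₂ _⇒_ (csub-con φ) (csub-con ψ)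
  csub-con (∀' φ) = cong ∀' (csub-con φ)
  csub-con (∃' φ) = cong ∃' (csub-con φ)

  csubs-con : (Δ : List Sentence) → csubs con Δ ≡ Δ
  csubs-con Δ = trans (map-cong csub-con Δ) (map-id Δ)

  _[_↦_] : ConstSub → ℕ → ClosedTerm → ConstSub
  (σ [ i ↦ t ]) k with k ≟ i
  ... | yes _ = t
  ... | no _ = σ k

  update-hit : ∀ σ i t → (σ [ i ↦ t ]) i ≡ t
  update-hit σ i t with i ≟ i
  ... | yes _ = refl
  ... | no i≢i = ⊥-elim (i≢i refl)

  update-miss : ∀ σ i t k → ¬ k ≡ i → (σ [ i ↦ t ]) k ≡ σ k
  update-miss σ i t k k≢i with k ≟ i
  ... | yes k≡i = ⊥-elim (k≢i k≡i)
  ... | no _ = refl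

  csub-update-fresh : ∀ {n} σ i t (φ : Form n) → ¬ occF i φ → csub (σ [ i ↦ t ]) φ ≡ csub σ φ
  csub-update-fresh σ i t φ i∉φ = csub-agree (σ [ i ↦ t ]) σ φ
    (λ k o → update-miss σ i t k (λ k≡i → i∉φ (subst (λ z → occF z φ) k≡i o)))

  csubs-update-fresh : ∀ σ i t {Δ} → Fresh i Δ → csubs (σ [ i ↦ t ]) Δ ≡ csubs σ Δ
  csubs-update-fresh σ i t fr = map-cong-local (All.map (csub-update-fresh σ i t _) fr)

  csub-update-inst : ∀ σ i t (φ : Form 1) → ¬ occF i φ →
                     csub (σ [ i ↦ t ]) (inst φ (con i)) ≡ inst (csub σ φ) t
  csub-update-inst σ i t φ i∉φ = trans (csub-inst (σ [ i ↦ t ]) φ (con i))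
    (cong₂ inst (csub-update-fresh σ i t φ i∉φ) (trans (cong close (update-hit σ i t)) (close-id t)))

  mutual
    occT-ren : ∀ {m n i} (ρ : Fin m → Fin n) (t : Term m) → occT i (renT ρ t) → occT i t
    occT-ren ρ (var x) ()
    occT-ren ρ (con j) o = o
    occT-ren ρ (app f ts) o = occTs-ren ρ ts o

    occTs-ren : ∀ {m n k i} (ρ : Fin m → Fin n) (ts : Vec (Term m) k) →
                occTs i (renTs ρ ts) → occTs i ts
    occTs-ren ρ [] ()
    occTs-ren ρ (t ∷ ts) (inj₁ o) = inj₁ (occT-ren ρ t o)
    occTs-ren ρ (t ∷ ts) (inj₂ o) = inj₂ (occTs-ren ρ ts o)

  occF-ren : ∀ {m n i} (ρ : Fin m → Fin n) (φ : Form m) → occF i (ren ρ φ) → occF i φ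
  occF-ren ρ (atom r ts) o = occTs-ren ρ ts o
  occF-ren ρ (φ ∧' ψ) (inj₁ o) = inj₁ (occF-ren ρ φ o)
  occF-ren ρ (φ ∧' ψ) (inj₂ o) = inj₂ (occF-ren ρ ψ o)
  occF-ren ρ (φ ∨' ψ) (inj₁ o) = inj₁ (occF-ren ρ φ o)
  occF-ren ρ (φ ∨' ψ) (inj₂ o) = inj₂ (occF-ren ρ ψ o)
  occF-ren ρ (φ ⇒ ψ) (inj₁ o) = inj₁ (occF-ren ρ φ o)
  occF-ren ρ (φ ⇒ ψ) (inj₂ o) = inj₂ (occF-ren ρ ψ o)
  occF-ren ρ (∀' φ) o = occF-ren (ext ρ) φ o
  occF-ren ρ (∃' φ) o = occF-ren (ext ρ) φ o

  mutual
    maxConstT : ∀ {n} → Term n → ℕ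
    maxConstT (var x) = 0
    maxConstT (con i) = i
    maxConstT (app f ts) = maxConstTs ts

    maxConstTs : ∀ {n k} → Vec (Term n) k → ℕ
    maxConstTs [] = 0
    maxConstTs (t ∷ ts) = maxConstT t ⊔ maxConstTs ts

  maxConst : ∀ {n} → Form n → ℕ
  maxConst (atom r ts) = maxConstTs ts
  maxConst ⊤' = 0
  maxConst ⊥' = 0
  maxConst (φ ∧' ψ) = maxConst φ ⊔ maxConst ψ
  maxConst (φ ∨' ψ) = maxConst φ ⊔ maxConst ψ
  maxConst (φ ⇒ ψ) = maxConst φ ⊔ maxConst ψ
  maxConst (∀' φ) = maxConst φ
  maxConst (∃' φ) = maxConst φ

  mutual
    occT-≤ : ∀ {n i} (t : Term n) → occT i t → i ≤ maxConstT t
    occT-≤ (var x) ()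
    occT-≤ (con j) o = ≤-reflexive o
    occT-≤ (app f ts) o = occTs-≤ ts o

    occTs-≤ : ∀ {n k i} (ts : Vec (Term n) k) → occTs i ts → i ≤ maxConstTs ts
    occTs-≤ [] ()
    occTs-≤ (t ∷ ts) (inj₁ o) = ≤-trans (occT-≤ t o) (m≤m⊔n _ _)
    occTs-≤ (t ∷ ts) (inj₂ o) = ≤-trans (occTs-≤ ts o) (m≤n⊔m _ _)

  occF-≤ : ∀ {n i} (φ : Form n) → occF i φ → i ≤ maxConst φ
  occF-≤ (atom r ts) o = occTs-≤ ts o
  occF-≤ (φ ∧' ψ) (inj₁ o) = ≤-trans (occF-≤ φ o) (m≤m⊔n _ _)
  occF-≤ (φ ∧' ψ) (inj₂ o) = ≤-trans (occF-≤ ψ o) (m≤n⊔m _ _)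
  occF-≤ (φ ∨' ψ) (inj₁ o) = ≤-trans (occF-≤ φ o) (m≤m⊔n _ _)
  occF-≤ (φ ∨' ψ) (inj₂ o) = ≤-trans (occF-≤ ψ o) (m≤n⊔m _ _)
  occF-≤ (φ ⇒ ψ) (inj₁ o) = ≤-trans (occF-≤ φ o) (m≤m⊔n _ _)
  occF-≤ (φ ⇒ ψ) (inj₂ o) = ≤-trans (occF-≤ ψ o) (m≤n⊔m _ _)
  occF-≤ (∀' φ) o = occF-≤ φ o
  occF-≤ (∃' φ) o = occF-≤ φ o

  freshConst : ∀ {n} (φ : Form n) → ∃ λ i → ¬ occF i φ
  freshConst φ = suc (maxConst φ) , λ o → 1+n≰n (occF-≤ φ o)

-- (2) Derivable facts of NBQL_CD, mostly about conjunctions of lists.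
module DerivableFacts (L : Signature) where
  open Lang L
  open ConstantSubstitution L

  hyp₀ : ∀ {a Δ} → (a ∷ Δ) ⊢ a
  hyp₀ = hyp (here refl)

  hyp₁ : ∀ {a b Δ} → (a ∷ b ∷ Δ) ⊢ b
  hyp₁ = hyp (there (here refl))

  hyp≡ : ∀ {a b Δ} → a ≡ b → (a ∷ Δ) ⊢ b
  hyp≡ refl = hyp₀

  fromClosed : ∀ {Δ χ} → [] ⊢ χ → Δ ⊢ χ
  fromClosed = wkn (λ ())

  ⋀ : List Sentence → Sentence
  ⋀ [] = ⊤'
  ⋀ (d ∷ Δ) = d ∧' ⋀ Δ

  ∀E-csub : ∀ σ (φ : Form 1) t → (csub σ (∀' φ) ∷ []) ⊢ csub σ (inst φ t)
  ∀E-csub σ φ t = subst ((_ ∷ []) ⊢_) (sym (csub-inst σ φ t)) (∀E (csubT σ t) hyp₀)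

  ∃I-csub : ∀ σ (φ : Form 1) t → (csub σ (inst φ t) ∷ []) ⊢ csub σ (∃' φ)
  ∃I-csub σ φ t = ∃I (csubT σ t) (hyp≡ (csub-inst σ φ t))

  i∀I-csub : ∀ σ (φ : Sentence) (ψ : Form 1) → (csub σ (∀' (wk φ ⇒ ψ)) ∷ []) ⊢ csub σ (φ ⇒ ∀' ψ)
  i∀I-csub σ φ ψ = i∀I (hyp≡ (cong (λ z → ∀' (z ⇒ csub σ ψ)) (csub-wk σ φ)))

  i∃E-csub : ∀ σ (φ : Form 1) (ψ : Sentence) → (csub σ (∀' (φ ⇒ wk ψ)) ∷ []) ⊢ csub σ (∃' φ ⇒ ψ)
  i∃E-csub σ φ ψ = i∃E (hyp≡ (cong (λ z → ∀' (csub σ φ ⇒ z)) (csub-wk σ ψ)))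

  CD-csub : ∀ σ (φ : Sentence) (ψ : Form 1) → (csub σ (∀' (wk φ ∨' ψ)) ∷ []) ⊢ csub σ (φ ∨' ∀' ψ)
  CD-csub σ φ ψ = CD (hyp≡ (cong (λ z → ∀' (z ∨' csub σ ψ)) (csub-wk σ φ)))

  ⋀-proj : ∀ {Δ d} → d ∈ Δ → [] ⊢ ⋀ Δ ⇒ d
  ⋀-proj (here refl) = ⇒I (∧E₁ hyp₀)
  ⋀-proj (there p) = iTrans (⇒I (∧E₂ hyp₀)) (⋀-proj p)

  ⋀-sub : ∀ {Δ} Δ₂ → Δ₂ ⊆ Δ → [] ⊢ ⋀ Δ ⇒ ⋀ Δ₂
  ⋀-sub [] _ = ⇒I ⊤I
  ⋀-sub (d ∷ Δ₂) s = i∧I (⋀-proj (s (here refl))) (⋀-sub Δ₂ (λ p → s (there p)))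

  ⋀-intro : ∀ {S Γ U} Γ' → Γ' ⊆ Γ → Γ ∣ U ⊢[ S ] ⋀ Γ'
  ⋀-intro [] _ = ⊤I
  ⋀-intro (d ∷ Γ') s = ∧I (hyp (s (here refl))) (⋀-intro Γ' (λ p → s (there p)))

  -- Distributivity laws, needed to internalise ∨E and ∃E with side assumptions.
  ∧-∨-distrib : ∀ {a b A} → [] ⊢ (a ∨' b) ∧' A ⇒ (a ∧' A) ∨' (b ∧' A)
  ∧-∨-distrib = ⇒I (∨E (∧E₁ hyp₀) (∨I₁ (∧I hyp₀ (∧E₂ hyp₁))) (∨I₂ (∧I hyp₀ (∧E₂ hyp₁))))

  ∧-∃-distrib : (φ : Form 1) (B : Sentence) → [] ⊢ ∃' φ ∧' B ⇒ ∃' (φ ∧' wk B)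
  ∧-∃-distrib φ B with freshConst (∃' φ ∧' B)
  ... | j , j∉ = ⇒I (∃E j (j∉ ∘ inj₁) (j∉ ∘ map₂ (occF-ren (λ ()) B)) (j∉ ∷ []) (λ p → p)
                       (∧E₁ hyp₀)
                       (∃I (con j) (∧I hyp₀ (subst ((_ ∷ _ ∷ []) ⊢_) (sym (inst-wk B (con j)))
                                                    (∧E₂ hyp₁)))))

-- (3) Internal reasoning in a prime saturated theory S.  The lemmas
-- "S ∋ A → …" treat A → _ as a consequence operator inside S; the
-- invariants say that derivations are internalised into S.
module Saturated (L : Signature) (S : Lang.Sentence L → Set) (sat : Lang.Sat L S) where
  open Lang L
  open Sat sat
  open ConstantSubstitution L
  open DerivableFacts L

  derive : ∀ {Δ χ} → All S Δ → Δ ⊢ χ → S χ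
  derive a d = closed _ (_ , a , d)

  -- For fixed A, the set {b | S ∋ A → b} is closed under the rules of NBQL_CD.
  ⇒-trans : ∀ {A a b} → S (A ⇒ a) → S (a ⇒ b) → S (A ⇒ b)
  ⇒-trans x y = derive (x ∷ y ∷ []) (iTrans hyp₀ hyp₁)

  ⇒-pre : ∀ {A A' b} → [] ⊢ A' ⇒ A → S (A ⇒ b) → S (A' ⇒ b)
  ⇒-pre d x = derive (x ∷ []) (iTrans (fromClosed d) hyp₀)

  ⇒-post : ∀ {A a b} → S (A ⇒ a) → (a ∷ []) ⊢ b → S (A ⇒ b)
  ⇒-post x d =
    derive (x ∷ []) (iTrans hyp₀ (⇒I (wkn (λ { (here refl) → here refl ; (there ()) }) d)))

  ⇒-pair : ∀ {A a b} → S (A ⇒ a) → S (A ⇒ b) → S (A ⇒ a ∧' b)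
  ⇒-pair x y = derive (x ∷ y ∷ []) (i∧I hyp₀ hyp₁)

  ⇒-curry : ∀ {A a b} → S (a ∧' A ⇒ b) → S (A ⇒ (a ⇒ b))
  ⇒-curry x = derive (x ∷ []) (⇒I (iTrans (⇒I (∧I hyp₀ hyp₁)) hyp₁))

  ⇒-cases : ∀ {A a b χ} → S (A ⇒ a ∨' b) → S (a ∧' A ⇒ χ) → S (b ∧' A ⇒ χ) → S (A ⇒ χ)
  ⇒-cases x y z = ⇒-trans (⇒-trans (⇒-pair x (derive [] (⇒I hyp₀))) (derive [] ∧-∨-distrib))
                           (derive (y ∷ z ∷ []) (i∨E hyp₀ hyp₁))

  ⇒-∀ : ∀ {A} (φ : Form 1) → (∀ t → S (A ⇒ inst φ t)) → S (A ⇒ ∀' φ)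
  ⇒-∀ {A} φ h = derive (omega (wk A ⇒ φ) h' ∷ []) (i∀I hyp₀)
    where
      h' : ∀ t → S (inst (wk A) t ⇒ inst φ t)
      h' t = subst (λ z → S (z ⇒ inst φ t)) (sym (inst-wk A t)) (h t)

  ⇒-∃ : ∀ {A A₂ ψ} (φ : Form 1) → S (A ⇒ ∃' φ) → S (A ⇒ A₂) →
        (∀ t → S (inst φ t ∧' A₂ ⇒ ψ)) → S (A ⇒ ψ)
  ⇒-∃ {A₂ = A₂} {ψ} φ x y h =
    ⇒-trans (⇒-trans (⇒-pair x y) (derive [] (∧-∃-distrib φ A₂)))
            (derive (omega (φ ∧' wk A₂ ⇒ wk ψ) h' ∷ []) (i∃E hyp₀))
    where
      h' : ∀ t → S (inst φ t ∧' inst (wk A₂) t ⇒ inst (wk ψ) t)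
      h' t = subst₂ (λ a b → S (inst φ t ∧' a ⇒ b)) (sym (inst-wk A₂ t)) (sym (inst-wk ψ t)) (h t)

  Holds : ConstSub → List Sentence → Set
  Holds σ Δ = ∀ {d} → d ∈ Δ → S (csub σ d)

  holds-update : ∀ {σ Δ} i t → Fresh i Δ → Holds σ Δ → Holds (σ [ i ↦ t ]) Δ
  holds-update {σ} i t fr h {d} p =
    subst S (sym (csub-update-fresh σ i t d (All.lookup fr p))) (h p)

  ⋀-holds : ∀ σ Δ → Holds σ Δ → S (⋀ (csubs σ Δ))
  ⋀-holds σ [] h = derive [] ⊤I
  ⋀-holds σ (d ∷ Δ) h = derive (h (here refl) ∷ ⋀-holds σ Δ (h ∘ there) ∷ []) (∧I hyp₀ hyp₁)

  -- The ∀I and ∃E cases of the invariants: the eigenconstant a_i, fresh for the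
  -- context, is instantiated by every closed term t via σ [ i ↦ t ].
  ⇒-∀I-csub : ∀ σ {Δ} (φ : Form 1) i → ¬ occF i φ → Fresh i Δ →
              (∀ t → S (⋀ (csubs (σ [ i ↦ t ]) Δ) ⇒ csub (σ [ i ↦ t ]) (inst φ (con i)))) →
              S (⋀ (csubs σ Δ) ⇒ csub σ (∀' φ))
  ⇒-∀I-csub σ φ i i∉φ fr h = ⇒-∀ (csub σ φ) λ t →
    subst₂ (λ a b → S (⋀ a ⇒ b)) (csubs-update-fresh σ i t fr) (csub-update-inst σ i t φ i∉φ) (h t)

  ⇒-∃E-csub : ∀ σ {Δ Δ₂} (φ : Form 1) (ψ : Sentence) i → ¬ occF i φ → ¬ occF i ψ →
              Fresh i Δ₂ → Δ₂ ⊆ Δ → S (⋀ (csubs σ Δ) ⇒ csub σ (∃' φ)) →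
              (∀ t → S (⋀ (csubs (σ [ i ↦ t ]) (inst φ (con i) ∷ Δ₂)) ⇒ csub (σ [ i ↦ t ]) ψ)) →
              S (⋀ (csubs σ Δ) ⇒ csub σ ψ)
  ⇒-∃E-csub σ {Δ₂ = Δ₂} φ ψ i i∉φ i∉ψ fr s x h =
    ⇒-∃ (csub σ φ) x (derive [] (⋀-sub (csubs σ Δ₂) (map⁺ (csub σ) s))) λ t →
      subst₂ (λ a b → S (a ⇒ b))
             (cong₂ (λ x y → x ∧' ⋀ y) (csub-update-inst σ i t φ i∉φ) (csubs-update-fresh σ i t fr))
             (csub-update-fresh σ i t ψ i∉ψ) (h t)

  ⊢-internal : ∀ {Δ χ} → Δ ⊢ χ → ∀ σ → S (⋀ (csubs σ Δ) ⇒ csub σ χ)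
  ⊢-internal (hyp p) σ = derive [] (⋀-proj (∈-map⁺ (csub σ) p))
  ⊢-internal (wkn {Δ = Δ} s d) σ = ⇒-pre (⋀-sub (csubs σ Δ) (map⁺ (csub σ) s)) (⊢-internal d σ)
  ⊢-internal ⊤I σ = derive [] (⇒I ⊤I)
  ⊢-internal (⊥E d) σ = ⇒-post (⊢-internal d σ) (⊥E hyp₀)
  ⊢-internal (∧I d e) σ = ⇒-pair (⊢-internal d σ) (⊢-internal e σ)
  ⊢-internal (∧E₁ d) σ = ⇒-post (⊢-internal d σ) (∧E₁ hyp₀)
  ⊢-internal (∧E₂ d) σ = ⇒-post (⊢-internal d σ) (∧E₂ hyp₀)
  ⊢-internal (∨I₁ d) σ = ⇒-post (⊢-internal d σ) (∨I₁ hyp₀)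
  ⊢-internal (∨I₂ d) σ = ⇒-post (⊢-internal d σ) (∨I₂ hyp₀)
  ⊢-internal (∨E d e f) σ = ⇒-cases (⊢-internal d σ) (⊢-internal e σ) (⊢-internal f σ)
  ⊢-internal (⇒I d) σ = ⇒-curry (⊢-internal d σ)
  ⊢-internal (iTrans d e) σ =
    ⇒-post (⇒-pair (⊢-internal d σ) (⊢-internal e σ)) (iTrans (∧E₁ hyp₀) (∧E₂ hyp₀))
  ⊢-internal (i∧I d e) σ =
    ⇒-post (⇒-pair (⊢-internal d σ) (⊢-internal e σ)) (i∧I (∧E₁ hyp₀) (∧E₂ hyp₀))
  ⊢-internal (i∨E d e) σ =
    ⇒-post (⇒-pair (⊢-internal d σ) (⊢-internal e σ)) (i∨E (∧E₁ hyp₀) (∧E₂ hyp₀))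
  ⊢-internal (i∀I {φ = φ} {ψ} d) σ = ⇒-post (⊢-internal d σ) (i∀I-csub σ φ ψ)
  ⊢-internal (i∃E {φ = φ} {ψ} d) σ = ⇒-post (⊢-internal d σ) (i∃E-csub σ φ ψ)
  ⊢-internal (∀I {φ = φ} i i∉φ fr d) σ =
    ⇒-∀I-csub σ φ i i∉φ fr λ t → ⊢-internal d (σ [ i ↦ t ])
  ⊢-internal (∀E {φ = φ} t d) σ = ⇒-post (⊢-internal d σ) (∀E-csub σ φ t)
  ⊢-internal (CD {φ = φ} {ψ} d) σ = ⇒-post (⊢-internal d σ) (CD-csub σ φ ψ)
  ⊢-internal (∃I {φ = φ} t d) σ = ⇒-post (⊢-internal d σ) (∃I-csub σ φ t)
  ⊢-internal (∃E {φ = φ} {ψ} i i∉φ i∉ψ fr s d e) σ =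
    ⇒-∃E-csub σ φ ψ i i∉φ i∉ψ fr s (⊢-internal d σ) λ t → ⊢-internal e (σ [ i ↦ t ])

  ⊢-preserves : ∀ {Δ χ} → Δ ⊢ χ → ∀ σ → Holds σ Δ → S (csub σ χ)
  ⊢-preserves (hyp p) σ h = h p
  ⊢-preserves (wkn s d) σ h = ⊢-preserves d σ (λ p → h (s p))
  ⊢-preserves ⊤I σ h = derive [] ⊤I
  ⊢-preserves (⊥E d) σ h = ⊥-elim (consistent (⊢-preserves d σ h))
  ⊢-preserves (∧I d e) σ h = derive (⊢-preserves d σ h ∷ ⊢-preserves e σ h ∷ []) (∧I hyp₀ hyp₁)
  ⊢-preserves (∧E₁ d) σ h = derive (⊢-preserves d σ h ∷ []) (∧E₁ hyp₀)
  ⊢-preserves (∧E₂ d) σ h = derive (⊢-preserves d σ h ∷ []) (∧E₂ hyp₀)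
  ⊢-preserves (∨I₁ d) σ h = derive (⊢-preserves d σ h ∷ []) (∨I₁ hyp₀)
  ⊢-preserves (∨I₂ d) σ h = derive (⊢-preserves d σ h ∷ []) (∨I₂ hyp₀)
  ⊢-preserves (∨E d e f) σ h with prime _ _ (⊢-preserves d σ h)
  ... | inj₁ x = ⊢-preserves e σ λ { (here refl) → x ; (there p) → h p }
  ... | inj₂ x = ⊢-preserves f σ λ { (here refl) → x ; (there p) → h p }
  ⊢-preserves {Δ} (⇒I d) σ h =
    ⇒-trans (derive (⋀-holds σ Δ h ∷ []) (⇒I (∧I hyp₀ hyp₁))) (⊢-internal d σ)
  ⊢-preserves (iTrans d e) σ h =
    derive (⊢-preserves d σ h ∷ ⊢-preserves e σ h ∷ []) (iTrans hyp₀ hyp₁)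
  ⊢-preserves (i∧I d e) σ h =
    derive (⊢-preserves d σ h ∷ ⊢-preserves e σ h ∷ []) (i∧I hyp₀ hyp₁)
  ⊢-preserves (i∨E d e) σ h =
    derive (⊢-preserves d σ h ∷ ⊢-preserves e σ h ∷ []) (i∨E hyp₀ hyp₁)
  ⊢-preserves (i∀I {φ = φ} {ψ} d) σ h = derive (⊢-preserves d σ h ∷ []) (i∀I-csub σ φ ψ)
  ⊢-preserves (i∃E {φ = φ} {ψ} d) σ h = derive (⊢-preserves d σ h ∷ []) (i∃E-csub σ φ ψ)
  ⊢-preserves (∀I {φ = φ} i i∉φ fr d) σ h = omega (csub σ φ) λ t →
    subst S (csub-update-inst σ i t φ i∉φ) (⊢-preserves d (σ [ i ↦ t ]) (holds-update i t fr h))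
  ⊢-preserves (∀E {φ = φ} t d) σ h = derive (⊢-preserves d σ h ∷ []) (∀E-csub σ φ t)
  ⊢-preserves (CD {φ = φ} {ψ} d) σ h = derive (⊢-preserves d σ h ∷ []) (CD-csub σ φ ψ)
  ⊢-preserves (∃I {φ = φ} t d) σ h = derive (⊢-preserves d σ h ∷ []) (∃I-csub σ φ t)
  ⊢-preserves (∃E {φ = φ} {ψ} i i∉φ i∉ψ fr s d e) σ h with witness (csub σ φ) (⊢-preserves d σ h)
  ... | t , x = subst S (csub-update-fresh σ i t ψ i∉ψ) (⊢-preserves e (σ [ i ↦ t ]) h')
    where
      h' : Holds (σ [ i ↦ t ]) (inst φ (con i) ∷ _)
      h' (here refl) = subst S (sym (csub-update-inst σ i t φ i∉φ)) x
      h' (there p) = holds-update i t fr (λ q → h (s q)) p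

  Respects : ConstSub → List Sentence → Set
  Respects σ U = ∀ {u} → u ∈ U → S u → S (csub σ u)

  respects-update : ∀ {σ U U₂} i t → Fresh i U₂ → U₂ ⊆ U →
                    Respects σ U → Respects (σ [ i ↦ t ]) U₂
  respects-update {σ} i t fr s r {u} p su =
    subst S (sym (csub-update-fresh σ i t u (All.lookup fr p))) (r (s p) su)

  respects-con : ∀ U → Respects con U
  respects-con U {u} _ su = subst S (sym (csub-con u)) su

  -- Invariant 3: invariant 1 for NBQL_CD(S); the new rule is covered by
  -- invariant 2, as the unsafe premises of its NBQL_CD-derivation lie in S.
  ⊢S-internal : ∀ {Δ U χ} → Δ ∣ U ⊢[ S ] χ →
                ∀ σ → Respects σ U → S (⋀ (csubs σ Δ) ⇒ csub σ χ)
  ⊢S-internal (hyp p) σ r = derive [] (⋀-proj (∈-map⁺ (csub σ) p))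
  ⊢S-internal (wkn {Δ = Δ} s u d) σ r =
    ⇒-pre (⋀-sub (csubs σ Δ) (map⁺ (csub σ) s)) (⊢S-internal d σ (r ∘ u))
  ⊢S-internal ⊤I σ r = derive [] (⇒I ⊤I)
  ⊢S-internal (⊥E d) σ r = ⇒-post (⊢S-internal d σ r) (⊥E hyp₀)
  ⊢S-internal (∧I d e) σ r = ⇒-pair (⊢S-internal d σ r) (⊢S-internal e σ r)
  ⊢S-internal (∧E₁ d) σ r = ⇒-post (⊢S-internal d σ r) (∧E₁ hyp₀)
  ⊢S-internal (∧E₂ d) σ r = ⇒-post (⊢S-internal d σ r) (∧E₂ hyp₀)
  ⊢S-internal (∨I₁ d) σ r = ⇒-post (⊢S-internal d σ r) (∨I₁ hyp₀)
  ⊢S-internal (∨I₂ d) σ r = ⇒-post (⊢S-internal d σ r) (∨I₂ hyp₀)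
  ⊢S-internal (∨E d e f) σ r = ⇒-cases (⊢S-internal d σ r) (⊢S-internal e σ r) (⊢S-internal f σ r)
  ⊢S-internal (⇒I d) σ r = ⇒-curry (⊢S-internal d σ r)
  ⊢S-internal (iTrans d e) σ r =
    ⇒-post (⇒-pair (⊢S-internal d σ r) (⊢S-internal e σ r)) (iTrans (∧E₁ hyp₀) (∧E₂ hyp₀))
  ⊢S-internal (i∧I d e) σ r =
    ⇒-post (⇒-pair (⊢S-internal d σ r) (⊢S-internal e σ r)) (i∧I (∧E₁ hyp₀) (∧E₂ hyp₀))
  ⊢S-internal (i∨E d e) σ r =
    ⇒-post (⇒-pair (⊢S-internal d σ r) (⊢S-internal e σ r)) (i∨E (∧E₁ hyp₀) (∧E₂ hyp₀))
  ⊢S-internal (i∀I {φ = φ} {ψ} d) σ r = ⇒-post (⊢S-internal d σ r) (i∀I-csub σ φ ψ)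
  ⊢S-internal (i∃E {φ = φ} {ψ} d) σ r = ⇒-post (⊢S-internal d σ r) (i∃E-csub σ φ ψ)
  ⊢S-internal (∀I {φ = φ} i i∉φ fr frU d) σ r =
    ⇒-∀I-csub σ φ i i∉φ fr λ t → ⊢S-internal d (σ [ i ↦ t ]) (respects-update i t frU (λ p → p) r)
  ⊢S-internal (∀E {φ = φ} t d) σ r = ⇒-post (⊢S-internal d σ r) (∀E-csub σ φ t)
  ⊢S-internal (CD {φ = φ} {ψ} d) σ r = ⇒-post (⊢S-internal d σ r) (CD-csub σ φ ψ)
  ⊢S-internal (∃I {φ = φ} t d) σ r = ⇒-post (⊢S-internal d σ r) (∃I-csub σ φ t)
  ⊢S-internal (∃E {φ = φ} {ψ} i i∉φ i∉ψ fr frU s u d e) σ r =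
    ⇒-∃E-csub σ φ ψ i i∉φ i∉ψ fr s (⊢S-internal d σ r) λ t →
      ⊢S-internal e (σ [ i ↦ t ]) (respects-update i t frU u r)
  ⊢S-internal (S-MP U₀ a s d e) σ r =
    ⇒-trans (⊢S-internal e σ r) (⊢-preserves d σ (λ p → r (s p) (All.lookup a p)))

  deduce : ∀ Γ {χ} → (S ∪ Γ) ⊩[ S ] χ → S (⋀ Γ ⇒ χ)
  deduce Γ {χ} (Δ , U , aΔ , _ , d) =
    ⇒-trans (⋀Γ⇒⋀ aΔ)
            (subst₂ (λ a b → S (⋀ a ⇒ b)) (csubs-con Δ) (csub-con χ)
                    (⊢S-internal d con (respects-con U)))
    where
      ⋀Γ⇒⋀ : ∀ {Δ} → All (S ∪ Γ) Δ → S (⋀ Γ ⇒ ⋀ Δ)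
      ⋀Γ⇒⋀ [] = derive [] (⇒I ⊤I)
      ⋀Γ⇒⋀ (inj₁ sd ∷ a) = ⇒-pair (derive (sd ∷ []) (⇒I hyp₁)) (⋀Γ⇒⋀ a)
      ⋀Γ⇒⋀ (inj₂ m ∷ a) = ⇒-pair (derive [] (⋀-proj m)) (⋀Γ⇒⋀ a)

  ⇒-ωCD : ∀ {A} (φ : Sentence) (ψ : Form 1) →
          (∀ t → S (A ⇒ φ ∨' inst ψ t)) → S (A ⇒ φ ∨' ∀' ψ)
  ⇒-ωCD {A} φ ψ h = ⇒-post (⇒-∀ (wk φ ∨' ψ) h') (CD hyp₀)
    where
      h' : ∀ t → S (A ⇒ inst (wk φ) t ∨' inst ψ t)
      h' t = subst (λ z → S (A ⇒ z ∨' inst ψ t)) (sym (inst-wk φ t)) (h t)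

mainTheorem11 : (L : Signature) → Countable L →
    let open Lang L in
    (S : Sentence → Set) → Sat S →
    (Γ : List Sentence) (φ : Sentence) (ψ : Form 1) →
    ((t : ClosedTerm) → (S ∪ Γ) ⊩[ S ] (φ ∨' inst ψ t)) →
    (S ∪ Γ) ⊩[ S ] (φ ∨' ∀' ψ)
mainTheorem11 L _ S sat Γ φ ψ h =
  Γ , ⋀Γ⇒φ∨∀ψ ∷ [] , All.tabulate inj₂ , inj₁ inS ∷ [] ,
  S-MP (⋀Γ⇒φ∨∀ψ ∷ []) (inS ∷ []) (λ p → p) hyp₀ (⋀-intro Γ (λ p → p))
  where
    open Lang L
    open DerivableFacts L
    open Saturated L S sat

    ⋀Γ⇒φ∨∀ψ : Sentence
    ⋀Γ⇒φ∨∀ψ = ⋀ Γ ⇒ φ ∨' ∀' ψ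

    inS : S ⋀Γ⇒φ∨∀ψ
    inS = ⇒-ωCD φ ψ (λ t → deduce Γ (h t))
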